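{- Let $A$ be a type of Martin-Löf type theory, and let $A_{rw}$ be the structure whose objects are the terms $a : A$, whose morphisms $s : a \to b$ are the computational paths $a =_s b : A$, whose composition of $s : a \to b$ and $t : b \to c$ is $t \circ s := \tau(s,t) : a \to c$, and whose identity on $a$ is the reflexive path $1_a := \rho_a : a \to a$. Then $A_{rw}$ is a weak groupoid: it satisfies the category laws (associativity and the two identity laws) up to $rw$-equality, and for every morphism $s : a \to b$ there is a morphism $t : b \to a$ with $t \circ s =_{rw} 1_a$ and $s \circ t =_{rw} 1_b$.
   Context: Computational paths: terms are considered up to $\alpha$-equivalence. The equality theory of type theory has the rules $\beta$: $(\lambda x.M)N = M[N/x]$; $\eta$: $\lambda x.Mx = M$ for $x\notin FV(M)$; $\rho$ (reflexivity): $M = M$; $\sigma$ (symmetry): from $M = N$ infer $N = M$; $\tau$ (transitivity): from $M = N$ and $N = P$ infer $M = P$; $\xi$: from $M = M'$ (under $x:A$) infer $\lambda x.M = \lambda x.M'$; $\mu$: from $M = M'$ infer $NM = NM'$; $\nu$: from $M = M'$ infer $MN = M'N$. A computational path $s$ from $a : A$ to $b : A$, written $a =_s b : A$, is a composition (via $\tau$) of rewrites, each an application of one of these rules or a change of bound variables; paths are written as terms built from the rule names, e.g. $\rho$, $\sigma(r)$, $\tau(r,s)$. Among the rewrite rules on paths (the system $LND_{EQ}$-$TRS$) are: $sr$: $\sigma(\rho) \rhd \rho$; $ss$: $\sigma(\sigma(r)) \rhd r$; $tr$: $\tau(r,\sigma(r)) \rhd \rho$ (for $r$ from $x$ to $y$,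 result $\rho_x$); $tsr$: $\tau(\sigma(r),r) \rhd \rho$ (result $\rho_y$); $trr$: $\tau(r,\rho) \rhd r$; $tlr$: $\tau(\rho,r) \rhd r$; $tt$: $\tau(\tau(t,r),s) \rhd \tau(t,\tau(r,s))$. An $rw$-rule is any rule of $LND_{EQ}$-$TRS$. We write $s \rhd_{1rw} t$ if $t$ is obtained from $s$ by one application of an $rw$-rule, and $s =_{rw} t$ ($s$ is $rw$-equal to $t$) if there is a finite (possibly empty) sequence $s \equiv R_0, \dots, R_n \equiv t$ with $R_i \rhd_{1rw} R_{i+1}$ or $R_{i+1} \rhd_{1rw} R_i$ for each $i$. -}

module Defs where

open import Data.Nat using (ℕ; zero; suc; _<ᵇ_; _≡ᵇ_; pred)
open import Data.Bool using (if_then_else_)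
open import Relation.Binary.Construct.Closure.Equivalence using (EqClosure)

-- Terms (lambda terms up to α-equivalence: de Bruijn indices, so
-- α-equivalent terms are syntactically identical and "change of bound
-- variables" steps are trivial).

data Term : Set where
  var : ℕ → Term
  lam : Term → Term
  app : Term → Term → Term

shift : ℕ → Term → Term
shift c (var n)   = if n <ᵇ c then var n else var (suc n)
shift c (lam M)   = lam (shift (suc c) M)
shift c (app M N) = app (shift c M) (shift c N)

sub : ℕ → Term → Term → Term
sub j N (var n)   = if n ≡ᵇ j then N else (if j <ᵇ n then var (pred n) else var n)
sub j N (lam M)   = lam (sub (suc j) (shift 0 N) M)
sub j N (app M P) = app (sub j N M) (sub j N P)

_[_] : Term → Term → Term
M [ N ] = sub 0 N M

data Path : Term → Term → Set where
  β : (M N : Term) → Path (app (lam M) N) (M [ N ])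
  η : (M : Term) → Path (lam (app (shift 0 M) (var 0))) M
  ρ : {M : Term} → Path M M
  σ : {M N : Term} → Path M N → Path N M
  τ : {M N P : Term} → Path M N → Path N P → Path M P
  ξ : {M M′ : Term} → Path M M′ → Path (lam M) (lam M′)
  μ : (N : Term) {M M′ : Term} → Path M M′ → Path (app N M) (app N M′)
  ν : (N : Term) {M M′ : Term} → Path M M′ → Path (app M N) (app M′ N)

-- rw-rules (the listed rules of LND_EQ-TRS), at the root

data _▷_ : {a b : Term} → Path a b → Path a b → Set where
  sr  : {x : Term} → σ (ρ {x}) ▷ ρ
  ss  : {x y : Term} (r : Path x y) → σ (σ r) ▷ r
  tr  : {x y : Term} (r : Path x y) → τ r (σ r) ▷ ρ
  tsr : {x y : Term} (r : Path x y) → τ (σ r) r ▷ ρ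
  trr : {x y : Term} (r : Path x y) → τ r ρ ▷ r
  tlr : {x y : Term} (r : Path x y) → τ ρ r ▷ r
  tt  : {w x y z : Term} (t : Path w x) (r : Path x y) (s : Path y z) →
        τ (τ t r) s ▷ τ t (τ r s)

data _▷1rw_ : {a b : Term} → Path a b → Path a b → Set where
  root : {a b : Term} {s t : Path a b} → s ▷ t → s ▷1rw t
  σ-c  : {a b : Term} {s t : Path a b} → s ▷1rw t → σ s ▷1rw σ t
  τ-l  : {a b c : Term} {s t : Path a b} (u : Path b c) → s ▷1rw t → τ s u ▷1rw τ t u
  τ-r  : {a b c : Term} (u : Path a b) {s t : Path b c} → s ▷1rw t → τ u s ▷1rw τ u t
  ξ-c  : {a b : Term} {s t : Path a b} → s ▷1rw t → ξ s ▷1rw ξ t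
  μ-c  : (N : Term) {a b : Term} {s t : Path a b} → s ▷1rw t → μ N s ▷1rw μ N t
  ν-c  : (N : Term) {a b : Term} {s t : Path a b} → s ▷1rw t → ν N s ▷1rw ν N t

_=rw_ : {a b : Term} → Path a b → Path a b → Set
_=rw_ {a} {b} = EqClosure (_▷1rw_ {a} {b})

_∘p_ : {a b c : Term} → Path b c → Path a b → Path a c
t ∘p s = τ s t

1p : (a : Term) → Path a a
1p a = ρ {a}

module Submission where

-- Each groupoid law is, up to the
-- order in which τ lists its arguments, literally one of the rw-rules of
-- LND_EQ-TRS applied at the root of the path term:
--   associativity  ↔ tt,   right identity ↔ tlr,   left identity ↔ trr,
--   inverses       ↔ tr and tsr, with σ(s) as the inverse of s.

open import Defs
open import Data.Product using (Σ; _×_; _,_)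
open import Relation.Binary.Construct.Closure.Equivalence using (return)

rule⇒rw : {a b : Term} {s t : Path a b} → s ▷ t → s =rw t
rule⇒rw step = return (root step)

∘p-assoc : {a b c d : Term} (s : Path a b) (t : Path b c) (u : Path c d) →
           (u ∘p (t ∘p s)) =rw ((u ∘p t) ∘p s)
∘p-assoc s t u = rule⇒rw (tt s t u)

∘p-identityʳ : {a b : Term} (s : Path a b) → (s ∘p 1p a) =rw s
∘p-identityʳ s = rule⇒rw (tlr s)

∘p-identityˡ : {a b : Term} (s : Path a b) → (1p b ∘p s) =rw s
∘p-identityˡ s = rule⇒rw (trr s)

∘p-inverseˡ : {a b : Term} (s : Path a b) → (σ s ∘p s) =rw 1p a
∘p-inverseˡ s = rule⇒rw (tr s)

∘p-inverseʳ : {a b : Term} (s : Path a b) → (s ∘p σ s) =rw 1p b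
∘p-inverseʳ s = rule⇒rw (tsr s)

proposition4p1 :
    ((a b c d : Term) (s : Path a b) (t : Path b c) (u : Path c d) →
       (u ∘p (t ∘p s)) =rw ((u ∘p t) ∘p s))
    × ((a b : Term) (s : Path a b) → (s ∘p 1p a) =rw s)
    × ((a b : Term) (s : Path a b) → (1p b ∘p s) =rw s)
    × ((a b : Term) (s : Path a b) →
         Σ (Path b a) (λ t → ((t ∘p s) =rw 1p a) × ((s ∘p t) =rw 1p b)))
proposition4p1 =
    (λ _ _ _ _ → ∘p-assoc)
  , (λ _ _ → ∘p-identityʳ)
  , (λ _ _ → ∘p-identityˡ)
  , (λ _ _ s → σ s , ∘p-inverseˡ s , ∘p-inverseʳ s)
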